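{- For every integer $n\ge 2$, $\mathrm{mpf}_{3,n}(1)=n^3-2n$.
   Context: $[n]=\{1,\dots,n\}$. The $t$-metered parking scheme for $\alpha=(a_1,\dots,a_m)\in[n]^m$: there are $n$ spots $1,\dots,n$; cars $1,\dots,m$ arrive in order; car $i$ drives to spot $a_i$, parks there if unoccupied, and otherwise parks in the first unoccupied spot numbered greater than $a_i$; if there is none, the car fails to park. Immediately after car $j$ parks, car $j-t$ (if $j-t\ge1$) leaves. $\alpha$ is a $t$-metered $(m,n)$-parking function if all $m$ cars park; $\mathrm{mpf}_{m,n}(t)$ is the number of such $\alpha\in[n]^m$. -}

module Defs where

open import Data.Nat using (ℕ; zero; suc; _+_; _*_; _∸_; _≤ᵇ_; _<ᵇ_; _≡ᵇ_)
open import Data.Bool using (Bool; true; false; if_then_else_; _∧_; _∨_; not)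
open import Data.Bool.ListAction using (any)
open import Data.List using (List; []; _∷_; _++_; length; drop; map; concatMap; filter; upTo; [_])
open import Data.Maybe using (Maybe; just; nothing)

-- Spots and preferences are numbered 1..n (elements of [n] = {1,…,n}).

occupied : List ℕ → ℕ → Bool
occupied occ s = any (λ x → x ≡ᵇ s) occ

findSpotFrom : ℕ → List ℕ → ℕ → ℕ → Maybe ℕ
findSpotFrom n occ s zero = nothing
findSpotFrom n occ s (suc fuel) =
  if n <ᵇ s then nothing
  else (if occupied occ s then findSpotFrom n occ (suc s) fuel else just s)

findSpot : ℕ → List ℕ → ℕ → Maybe ℕ
findSpot n occ a = findSpotFrom n occ a (suc n)

-- State: the spots of the currently parked cars, in order of arrival
-- (oldest first).  After car j parks, car j - t leaves (if j - t ≥ 1):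
-- equivalently, only the last t cars to have parked remain.
meteredRun : ℕ → ℕ → List ℕ → List ℕ → Bool
meteredRun t n parked [] = true
meteredRun t n parked (a ∷ as) with findSpot n parked a
... | nothing = false
... | just s  =
  let parked' = parked ++ [ s ]
  in meteredRun t n (drop (length parked' ∸ t) parked') as

isMeteredPF : ℕ → ℕ → List ℕ → Bool
isMeteredPF t n α = meteredRun t n [] α

seqs : ℕ → ℕ → List (List ℕ)
seqs zero n = [ [] ]
seqs (suc m) n = concatMap (λ a → map (a ∷_) (seqs m n)) (map suc (upTo n))

mpf : ℕ → ℕ → ℕ → ℕ
mpf m n t = length (filter (λ α → isMeteredPF t n α Data.Bool.≟ true) (seqs m n))

-- With t = 1 only the most recently parked car is present, so a car fails exactly when it
-- prefers spot n while the previous car occupies n.  Hence (a, b, c) fails iff a = b = n, or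
-- a ≠ n = b = c, or (a, b, c) = (n − 1, n − 1, n) (the second car is pushed from n − 1 to n).
-- These cases are disjoint and each is a product of point indicators, so summing over [n]³
-- counts n + (n − 1) + 1 = 2n failures.

module Submission where

open import Data.Bool using (Bool; true; false; T; not)
import Data.Bool as Bool
open import Data.Bool.Properties using (T-≡)
open import Function.Bundles using (Equivalence)
open import Data.List using (List; []; _∷_; _++_; [_]; map; concatMap; filter; length; upTo)
open import Data.List.Properties using (map-∘; map-++; map-cong; map-applyUpTo; length-map; length-upTo)
open import Data.List.Relation.Unary.All using (All; []; _∷_)
open import Data.List.Relation.Unary.All.Properties using (map⁺; applyUpTo⁺₁)
open import Data.Maybe using (just; nothing)
open import Data.Nat
open import Data.Nat.ListAction using (sum)
open import Data.Nat.ListAction.Properties using (sum-++)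
open import Data.Nat.Properties
open import Data.Nat.Tactic.RingSolver using (solve-∀)
open import Algebra.Properties.CommutativeSemigroup +-commutativeSemigroup using () renaming (interchange to +-interchange)
open import Function using (_∘_; id)
open import Relation.Binary.PropositionalEquality hiding ([_])
open import Relation.Nullary using (yes; no; contradiction)

open import Defs

≡ᵇ-refl : ∀ m → (m ≡ᵇ m) ≡ true
≡ᵇ-refl zero    = refl
≡ᵇ-refl (suc m) = ≡ᵇ-refl m

≢⇒≡ᵇ≡false : ∀ {m n} → m ≢ n → (m ≡ᵇ n) ≡ false
≢⇒≡ᵇ≡false {m} {n} m≢n with m ≡ᵇ n in eq
... | false = refl
... | true  = contradiction (≡ᵇ⇒≡ m n (subst T (sym eq) _)) m≢n

≤⇒<ᵇ≡false : ∀ {m n} → m ≤ n → (n <ᵇ m) ≡ false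
≤⇒<ᵇ≡false {m} {n} m≤n with n <ᵇ m in eq
... | false = refl
... | true  = contradiction m≤n (<⇒≱ (<ᵇ⇒< n m (subst T (sym eq) _)))

<⇒<ᵇ≡true : ∀ {m n} → m < n → (m <ᵇ n) ≡ true
<⇒<ᵇ≡true m<n = Equivalence.to T-≡ (<⇒<ᵇ m<n)

𝟙 : Bool → ℕ
𝟙 true  = 1
𝟙 false = 0

𝟙-not+𝟙 : ∀ x → 𝟙 (not x) + 𝟙 x ≡ 1
𝟙-not+𝟙 true  = refl
𝟙-not+𝟙 false = refl

𝟙-idem : ∀ x → 𝟙 x * 𝟙 x ≡ 𝟙 x
𝟙-idem true  = refl
𝟙-idem false = refl

∑ : {A : Set} → List A → (A → ℕ) → ℕ
∑ xs f = sum (map f xs)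

syntax ∑ xs (λ x → e) = ∑[ x ∈ xs ] e

module _ {A : Set} where

  ∑-cong : ∀ {f g : A → ℕ} xs → (∀ x → f x ≡ g x) → ∑ xs f ≡ ∑ xs g
  ∑-cong xs f≗g = cong sum (map-cong f≗g xs)

  ∑-cong-All : ∀ {P : A → Set} {f g : A → ℕ} {xs} → All P xs → (∀ {x} → P x → f x ≡ g x) → ∑ xs f ≡ ∑ xs g
  ∑-cong-All []         f≗g = refl
  ∑-cong-All (px ∷ pxs) f≗g = cong₂ _+_ (f≗g px) (∑-cong-All pxs f≗g)

  ∑-+ : ∀ (f g : A → ℕ) xs → ∑[ x ∈ xs ] (f x + g x) ≡ ∑ xs f + ∑ xs g
  ∑-+ f g []       = refl
  ∑-+ f g (x ∷ xs) = trans (cong (f x + g x +_) (∑-+ f g xs)) (+-interchange (f x) (g x) (∑ xs f) (∑ xs g))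

  ∑-*ˡ : ∀ k (f : A → ℕ) xs → ∑[ x ∈ xs ] (k * f x) ≡ k * ∑ xs f
  ∑-*ˡ k f []       = sym (*-zeroʳ k)
  ∑-*ˡ k f (x ∷ xs) = trans (cong (k * f x +_) (∑-*ˡ k f xs)) (sym (*-distribˡ-+ k (f x) _))

  ∑-*ʳ : ∀ k (f : A → ℕ) xs → ∑[ x ∈ xs ] (f x * k) ≡ ∑ xs f * k
  ∑-*ʳ k f []       = refl
  ∑-*ʳ k f (x ∷ xs) = trans (cong (f x * k +_) (∑-*ʳ k f xs)) (sym (*-distribʳ-+ k (f x) _))

  ∑-const : ∀ k (xs : List A) → ∑[ x ∈ xs ] k ≡ k * length xs
  ∑-const k []       = sym (*-zeroʳ k)
  ∑-const k (x ∷ xs) = trans (cong (k +_) (∑-const k xs)) (sym (*-suc k (length xs)))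

  ∑-not+∑ : ∀ (p : A → Bool) xs → ∑[ x ∈ xs ] 𝟙 (not (p x)) + ∑[ x ∈ xs ] 𝟙 (p x) ≡ length xs
  ∑-not+∑ p []       = refl
  ∑-not+∑ p (x ∷ xs) = trans (+-interchange (𝟙 (not (p x))) _ (𝟙 (p x)) _)
                             (cong₂ _+_ (𝟙-not+𝟙 (p x)) (∑-not+∑ p xs))

  length-filter≡∑ : ∀ (p : A → Bool) xs → length (filter (λ x → p x Bool.≟ true) xs) ≡ ∑[ x ∈ xs ] 𝟙 (p x)
  length-filter≡∑ p []       = refl
  length-filter≡∑ p (x ∷ xs) with p x
  ... | true  = cong suc (length-filter≡∑ p xs)
  ... | false = length-filter≡∑ p xs

  module _ {B : Set} where

    ∑-map : ∀ (f : B → ℕ) (h : A → B) xs → ∑ (map h xs) f ≡ ∑[ x ∈ xs ] f (h x)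
    ∑-map f h xs = cong sum (sym (map-∘ xs))

    ∑-concatMap : ∀ (f : B → ℕ) (g : A → List B) xs → ∑ (concatMap g xs) f ≡ ∑[ x ∈ xs ] ∑ (g x) f
    ∑-concatMap f g []       = refl
    ∑-concatMap f g (x ∷ xs) = begin
      sum (map f (g x ++ concatMap g xs))        ≡⟨ cong sum (map-++ f (g x) _) ⟩
      sum (map f (g x) ++ map f (concatMap g xs)) ≡⟨ sum-++ (map f (g x)) _ ⟩
      ∑ (g x) f + ∑ (concatMap g xs) f           ≡⟨ cong (∑ (g x) f +_) (∑-concatMap f g xs) ⟩
      ∑ (g x) f + ∑[ y ∈ xs ] ∑ (g y) f           ∎
      where open ≡-Reasoning

range : ℕ → List ℕ
range n = map suc (upTo n)

range-bounded : ∀ n → All (_≤ n) (range n)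
range-bounded n = map⁺ (applyUpTo⁺₁ id n id)

length-range : ∀ n → length (range n) ≡ n
length-range n = trans (length-map suc (upTo n)) (length-upTo n)

∑-range-1 : ∀ n → ∑[ x ∈ range n ] 1 ≡ n
∑-range-1 n = trans (∑-const 1 (range n)) (trans (*-identityˡ _) (length-range n))

∑-upTo-≡ᵇ : ∀ {m n} → m < n → ∑[ x ∈ upTo n ] 𝟙 (x ≡ᵇ m) ≡ 1
∑-upTo-≡ᵇ {zero}  {suc n} _          =
  cong suc (trans (cong (λ xs → ∑[ x ∈ xs ] 𝟙 (x ≡ᵇ 0)) (sym (map-applyUpTo id suc n)))
                  (trans (∑-map _ suc (upTo n)) (∑-const 0 (upTo n))))
∑-upTo-≡ᵇ {suc m} {suc n} (s<s m<n) =
  trans (cong (λ xs → ∑[ x ∈ xs ] 𝟙 (x ≡ᵇ suc m)) (sym (map-applyUpTo id suc n)))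
        (trans (∑-map _ suc (upTo n)) (∑-upTo-≡ᵇ m<n))

∑-range-≡ᵇ : ∀ {m n} → m < n → ∑[ x ∈ range n ] 𝟙 (x ≡ᵇ suc m) ≡ 1
∑-range-≡ᵇ {n = n} m<n = trans (∑-map _ suc (upTo n)) (∑-upTo-≡ᵇ m<n)

∑-seqs : ∀ l n (f : List ℕ → ℕ) → ∑ (seqs (suc l) n) f ≡ ∑[ a ∈ range n ] ∑[ α ∈ seqs l n ] f (a ∷ α)
∑-seqs l n f = trans (∑-concatMap f (λ a → map (a ∷_) (seqs l n)) (range n)) (∑-cong (range n) λ a → ∑-map f (a ∷_) (seqs l n))

∑³ : List ℕ → (ℕ → ℕ → ℕ → ℕ) → ℕ
∑³ xs F = ∑[ a ∈ xs ] ∑[ b ∈ xs ] ∑[ c ∈ xs ] F a b c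

∑-seqs-3 : ∀ n (f : List ℕ → ℕ) → ∑ (seqs 3 n) f ≡ ∑³ (range n) (λ a b c → f (a ∷ b ∷ c ∷ []))
∑-seqs-3 n f =
  trans (∑-seqs 2 n f) (∑-cong (range n) λ a →
  trans (∑-seqs 1 n _) (∑-cong (range n) λ b →
  trans (∑-seqs 0 n _) (∑-cong (range n) λ c → +-identityʳ _)))

∑³-cong-All : ∀ {P : ℕ → Set} {F G : ℕ → ℕ → ℕ → ℕ} {xs} → All P xs →
  (∀ {a b c} → P a → P b → P c → F a b c ≡ G a b c) → ∑³ xs F ≡ ∑³ xs G
∑³-cong-All ps F≗G = ∑-cong-All ps λ pa → ∑-cong-All ps λ pb → ∑-cong-All ps λ pc → F≗G pa pb pc

∑³-+ : ∀ (F G : ℕ → ℕ → ℕ → ℕ) xs → ∑³ xs (λ a b c → F a b c + G a b c) ≡ ∑³ xs F + ∑³ xs G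
∑³-+ F G xs =
  trans (∑-cong xs λ a → trans (∑-cong xs λ b → ∑-+ (F a b) (G a b) xs) (∑-+ _ _ xs)) (∑-+ _ _ xs)

∑³-product : ∀ (f g h : ℕ → ℕ) xs → ∑³ xs (λ a b c → f a * g b * h c) ≡ ∑ xs f * ∑ xs g * ∑ xs h
∑³-product f g h xs = begin
  ∑³ xs (λ a b c → f a * g b * h c)            ≡⟨ ∑-cong xs (λ a → ∑-cong xs λ b → ∑-*ˡ (f a * g b) h xs) ⟩
  ∑[ a ∈ xs ] ∑[ b ∈ xs ] (f a * g b * ∑ xs h) ≡⟨ ∑-cong xs (λ a → ∑-*ʳ (∑ xs h) (λ b → f a * g b) xs) ⟩
  ∑[ a ∈ xs ] (∑[ b ∈ xs ] (f a * g b) * ∑ xs h) ≡⟨ ∑-cong xs (λ a → cong (_* ∑ xs h) (∑-*ˡ (f a) g xs)) ⟩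
  ∑[ a ∈ xs ] (f a * ∑ xs g * ∑ xs h)          ≡⟨ ∑-*ʳ (∑ xs h) (λ a → f a * ∑ xs g) xs ⟩
  ∑[ a ∈ xs ] (f a * ∑ xs g) * ∑ xs h          ≡⟨ cong (_* ∑ xs h) (∑-*ʳ (∑ xs g) f xs) ⟩
  ∑ xs f * ∑ xs g * ∑ xs h                     ∎
  where open ≡-Reasoning

findSpot-empty : ∀ {n a} → a ≤ n → findSpot n [] a ≡ just a
findSpot-empty a≤n rewrite ≤⇒<ᵇ≡false a≤n = refl

findSpot-free : ∀ {n p b} → b ≤ n → p ≢ b → findSpot n [ p ] b ≡ just b
findSpot-free b≤n p≢b rewrite ≤⇒<ᵇ≡false b≤n | ≢⇒≡ᵇ≡false p≢b = refl

findSpot-bump : ∀ {n b} → b < n → findSpot n [ b ] b ≡ just (suc b)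
findSpot-bump {suc n} {b} b<n
  rewrite ≤⇒<ᵇ≡false (<⇒≤ b<n) | ≡ᵇ-refl b | ≤⇒<ᵇ≡false b<n | ≢⇒≡ᵇ≡false (<⇒≢ (n<1+n b)) = refl

findSpot-full : ∀ n → findSpot n [ n ] n ≡ nothing
findSpot-full zero = refl
findSpot-full (suc n) rewrite ≤⇒<ᵇ≡false (≤-refl {suc n}) | ≡ᵇ-refl n | <⇒<ᵇ≡true (n<1+n n) = refl

isMeteredPF-cons : ∀ {n a bs} → a ≤ n → isMeteredPF 1 n (a ∷ bs) ≡ meteredRun 1 n [ a ] bs
isMeteredPF-cons a≤n rewrite findSpot-empty a≤n = refl

meteredRun-free : ∀ {n p b bs} → b ≤ n → p ≢ b → meteredRun 1 n [ p ] (b ∷ bs) ≡ meteredRun 1 n [ b ] bs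
meteredRun-free b≤n p≢b rewrite findSpot-free b≤n p≢b = refl

meteredRun-bump : ∀ {n b bs} → b < n → meteredRun 1 n [ b ] (b ∷ bs) ≡ meteredRun 1 n [ suc b ] bs
meteredRun-bump b<n rewrite findSpot-bump b<n = refl

meteredRun-full : ∀ {n bs} → meteredRun 1 n [ n ] (n ∷ bs) ≡ false
meteredRun-full {n} rewrite findSpot-full n = refl

meteredRun-last : ∀ {n s c} → c ≤ n → 𝟙 (meteredRun 1 n [ s ] [ c ]) + 𝟙 (s ≡ᵇ n) * 𝟙 (c ≡ᵇ n) ≡ 1
meteredRun-last {n} {s} {c} c≤n with c ≟ s | c ≟ n
... | yes refl | yes refl rewrite meteredRun-full {n} {[]} | ≡ᵇ-refl n = refl
... | yes refl | no c≢n rewrite meteredRun-bump {bs = []} (≤∧≢⇒< c≤n c≢n) | ≢⇒≡ᵇ≡false c≢n = refl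
... | no c≢s | yes refl rewrite meteredRun-free {bs = []} c≤n (c≢s ∘ sym) | ≢⇒≡ᵇ≡false (c≢s ∘ sym) = refl
... | no c≢s | no c≢n rewrite meteredRun-free {bs = []} c≤n (c≢s ∘ sym) | ≢⇒≡ᵇ≡false c≢n | *-zeroʳ (𝟙 (s ≡ᵇ n)) = refl

failure : ℕ → ℕ → ℕ → ℕ → ℕ
failure n a b c =
    𝟙 (a ≡ᵇ n) * 𝟙 (b ≡ᵇ n) * 1
  + 𝟙 (not (a ≡ᵇ n)) * 𝟙 (b ≡ᵇ n) * 𝟙 (c ≡ᵇ n)
  + 𝟙 (a ≡ᵇ pred n) * 𝟙 (b ≡ᵇ pred n) * 𝟙 (c ≡ᵇ n)

-- Unless the second car is blocked, `failure` reduces to the factor 𝟙 (s ≡ᵇ n) * 𝟙 (c ≡ᵇ n)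
-- of meteredRun-last, where s is the spot the second car takes.
failure-blocked : ∀ m c → failure (suc m) (suc m) (suc m) c ≡ 1
failure-blocked m c rewrite ≡ᵇ-refl m | ≢⇒≡ᵇ≡false (<⇒≢ (n<1+n m) ∘ sym) = refl

failure-bumped : ∀ {m a} c → a ≢ suc m → failure (suc m) a a c ≡ 𝟙 (suc a ≡ᵇ suc m) * 𝟙 (c ≡ᵇ suc m)
failure-bumped {m} {a} c a≢n rewrite ≢⇒≡ᵇ≡false a≢n | 𝟙-idem (a ≡ᵇ m) = refl

failure-free : ∀ {m a b} c → a ≢ b → failure (suc m) a b c ≡ 𝟙 (b ≡ᵇ suc m) * 𝟙 (c ≡ᵇ suc m)
failure-free {m} {a} {b} c a≢b with b ≟ suc m
... | yes refl rewrite ≢⇒≡ᵇ≡false a≢b | ≡ᵇ-refl m | ≢⇒≡ᵇ≡false (<⇒≢ (n<1+n m) ∘ sym)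
                     | *-zeroʳ (𝟙 (a ≡ᵇ m)) | +-identityʳ (𝟙 (c ≡ᵇ suc m) + 0) = refl
... | no b≢n rewrite ≢⇒≡ᵇ≡false b≢n | *-zeroʳ (𝟙 (a ≡ᵇ suc m)) | *-zeroʳ (𝟙 (not (a ≡ᵇ suc m))) with a ≟ m
...   | yes refl rewrite ≡ᵇ-refl m | ≢⇒≡ᵇ≡false (a≢b ∘ sym) = refl
...   | no a≢m rewrite ≢⇒≡ᵇ≡false a≢m = refl

isMeteredPF-or-failure : ∀ {m a b c} → a ≤ suc m → b ≤ suc m → c ≤ suc m →
  𝟙 (isMeteredPF 1 (suc m) (a ∷ b ∷ c ∷ [])) + failure (suc m) a b c ≡ 1
isMeteredPF-or-failure {m} {a} {b} {c} a≤n b≤n c≤n with a ≟ b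
... | no a≢b = trans (cong₂ _+_ (cong 𝟙 (trans (isMeteredPF-cons a≤n) (meteredRun-free b≤n a≢b)))
                                (failure-free c a≢b))
                     (meteredRun-last c≤n)
... | yes refl with a ≟ suc m
...   | yes refl = cong₂ _+_ (cong 𝟙 (trans (isMeteredPF-cons a≤n) (meteredRun-full {suc m}))) (failure-blocked m c)
...   | no a≢n = trans (cong₂ _+_ (cong 𝟙 (trans (isMeteredPF-cons a≤n) (meteredRun-bump (≤∧≢⇒< a≤n a≢n))))
                                  (failure-bumped c a≢n))
                       (meteredRun-last c≤n)

mpf≡∑³ : ∀ n → mpf 3 n 1 ≡ ∑³ (range n) (λ a b c → 𝟙 (isMeteredPF 1 n (a ∷ b ∷ c ∷ [])))
mpf≡∑³ n = trans (length-filter≡∑ (isMeteredPF 1 n) (seqs 3 n)) (∑-seqs-3 n _)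

mpf+∑³-failure : ∀ m → let n = suc m in mpf 3 n 1 + ∑³ (range n) (failure n) ≡ n * n * n
mpf+∑³-failure m = begin
  mpf 3 n 1 + ∑³ (range n) (failure n)            ≡⟨ cong (_+ ∑³ (range n) (failure n)) (mpf≡∑³ n) ⟩
  ∑³ (range n) ok + ∑³ (range n) (failure n)      ≡⟨ ∑³-+ ok (failure n) (range n) ⟨
  ∑³ (range n) (λ a b c → ok a b c + failure n a b c)
    ≡⟨ ∑³-cong-All (range-bounded n) isMeteredPF-or-failure ⟩
  ∑³ (range n) (λ _ _ _ → 1)                       ≡⟨ ∑³-product (λ _ → 1) (λ _ → 1) (λ _ → 1) (range n) ⟩
  ∑[ x ∈ range n ] 1 * ∑[ x ∈ range n ] 1 * ∑[ x ∈ range n ] 1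
    ≡⟨ cong₂ _*_ (cong₂ _*_ (∑-range-1 n) (∑-range-1 n)) (∑-range-1 n) ⟩
  n * n * n                                        ∎
  where
  open ≡-Reasoning
  n = suc m
  ok : ℕ → ℕ → ℕ → ℕ
  ok a b c = 𝟙 (isMeteredPF 1 n (a ∷ b ∷ c ∷ []))

∑³-failure : ∀ k → let n = 2 + k in ∑³ (range n) (failure n) ≡ 2 * n
∑³-failure k = begin
  ∑³ (range n) (failure n)
    ≡⟨ ∑³-+ (λ a b c → blocked a b c + direct a b c) bumped (range n) ⟩
  ∑³ (range n) (λ a b c → blocked a b c + direct a b c) + ∑³ (range n) bumped
    ≡⟨ cong (_+ ∑³ (range n) bumped) (∑³-+ blocked direct (range n)) ⟩
  ∑³ (range n) blocked + ∑³ (range n) direct + ∑³ (range n) bumped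
    ≡⟨ cong₂ _+_ (cong₂ _+_ (∑³-product isN isN (λ _ → 1) (range n)) (∑³-product notN isN isN (range n)))
                 (∑³-product isPredN isPredN isN (range n)) ⟩
  #n * #n * ∑[ x ∈ range n ] 1 + #notN * #n * #n + #predN * #predN * #n
    ≡⟨ cong₂ (λ p q → p * p * q + #notN * p * p + #predN * #predN * p) #n≡1 (∑-range-1 n) ⟩
  1 * 1 * n + #notN * 1 * 1 + #predN * #predN * 1
    ≡⟨ cong (λ r → 1 * 1 * n + #notN * 1 * 1 + r * r * 1) #predN≡1 ⟩
  1 * 1 * n + #notN * 1 * 1 + 1 * 1 * 1            ≡⟨ simplify n #notN ⟩
  n + (#notN + 1)                                   ≡⟨ cong (n +_) #notN+1≡n ⟩
  n + n                                             ≡⟨ cong (n +_) (+-identityʳ n) ⟨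
  2 * n                                             ∎
  where
  open ≡-Reasoning
  n = 2 + k
  isN isPredN notN : ℕ → ℕ
  isN x = 𝟙 (x ≡ᵇ n)
  isPredN x = 𝟙 (x ≡ᵇ suc k)
  notN x = 𝟙 (not (x ≡ᵇ n))
  blocked direct bumped : ℕ → ℕ → ℕ → ℕ
  blocked a b c = isN a * isN b * 1
  direct a b c = notN a * isN b * isN c
  bumped a b c = isPredN a * isPredN b * isN c
  #n = ∑[ x ∈ range n ] isN x
  #predN = ∑[ x ∈ range n ] isPredN x
  #notN = ∑[ x ∈ range n ] notN x
  #n≡1 : #n ≡ 1
  #n≡1 = ∑-range-≡ᵇ (n<1+n (suc k))
  #predN≡1 : #predN ≡ 1
  #predN≡1 = ∑-range-≡ᵇ (m<n⇒m<1+n (n<1+n k))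
  simplify : ∀ x y → 1 * 1 * x + y * 1 * 1 + 1 * 1 * 1 ≡ x + (y + 1)
  simplify = solve-∀
  #notN+1≡n : #notN + 1 ≡ n
  #notN+1≡n = trans (cong (#notN +_) (sym #n≡1)) (trans (∑-not+∑ (_≡ᵇ n) (range n)) (length-range n))

proposition3p16 : (n : ℕ) → 2 ≤ n → mpf 3 n 1 ≡ n ^ 3 ∸ 2 * n
proposition3p16 n@(suc (suc k)) _ = begin
  mpf 3 n 1                                  ≡⟨ m+n∸n≡m (mpf 3 n 1) (2 * n) ⟨
  mpf 3 n 1 + 2 * n ∸ 2 * n                  ≡⟨ cong (λ x → mpf 3 n 1 + x ∸ 2 * n) (∑³-failure k) ⟨
  mpf 3 n 1 + ∑³ (range n) (failure n) ∸ 2 * n ≡⟨ cong (_∸ 2 * n) (mpf+∑³-failure (suc k)) ⟩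
  n * n * n ∸ 2 * n                          ≡⟨ cong (_∸ 2 * n) (*-assoc n n n) ⟩
  n * (n * n) ∸ 2 * n                        ≡⟨ cong (λ x → n * (n * x) ∸ 2 * n) (*-identityʳ n) ⟨
  n ^ 3 ∸ 2 * n                              ∎
  where open ≡-Reasoning
proposition3p16 (suc zero) (s≤s ())
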